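{- Let $k\ge 4$ and let $G$ be a graph with three vertices $x,y,z$ forming a clique of size $3$ in $G$. Suppose $G$ has a $k$-C-E ordering $\psi$ in which $y$ lies between $x$ and $z$. Then $G'=\mathcal C_k(G,x,y,z)$ has a $k$-C-E ordering $\phi$ with $\phi|_{V(G)}=\psi$.
   Context: All graphs are finite, simple and undirected. For an ordering $\phi$ of a set $V$ and $S\subseteq V$, $\phi|_S$ is the induced ordering of $S$. Write $a<_\phi b$ if $a$ precedes $b$; $w$ lies between $a$ and $b$ if $a<_\phi w<_\phi b$ or $b<_\phi w<_\phi a$. An ordering $\phi$ of $V(G)$ is a $k$-clique-extendible ordering ($k$-C-E ordering) of $G$ if whenever $X$ and $Y$ are cliques of size $k$ with $|X\cap Y|=k-1$, $X\setminus Y=\{a\}$, $Y\setminus X=\{b\}$, and all vertices of $X\cap Y$ lie between $a$ and $b$ in $\phi$, then $ab\in E(G)$. The graph $F_k$ has vertex set $K\cup I$, where $K=\{v_1,\dots,v_{2k-1}\}$ is a clique and $I=\{u_{i,j}: 1\le i<j\le 2k-1\}$ is an independent set, with $u_{i,j}$ adjacent to every vertex of $K$ except $v_i$ and $v_j$ and to nothing else; $\Gamma_k$ is $F_k$ with $u_{1,2}$ deleted. The graph $\mathcal C_k(G,x,y,z)$ is obtained from the disjoint union of $G$ and $\Gamma_k$ by identifying $x$ with $v_1$, $y$ with $v_3$, and $z$ with $v_2$ (identifying two vertices means replacing them by a single vertex adjacent to the union of their neighbourhoods); $V(G)$ is regarded as a subset of $V(G')$. -}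

module Defs where

open import Level using (0ℓ)
open import Data.Nat using (ℕ; zero; suc; _∸_; _*_; _<ᵇ_)
open import Data.Fin using (Fin; zero; suc; toℕ)
import Data.Fin.Properties as FinP
open import Data.Bool using (Bool; true; false; T; _∧_; not)
open import Data.Unit using (tt)
open import Data.Empty using (⊥)
open import Data.Product using (Σ; ∃; _×_; _,_)
open import Data.Sum using (_⊎_; inj₁; inj₂)
open import Data.Maybe using (Maybe; just; nothing)
open import Data.List using (List; []; _∷_; _++_; length; filter; mapMaybe)
open import Data.List.Relation.Unary.Unique.Propositional using (Unique)
open import Data.List.Membership.Propositional using (_∈_; _∉_)
import Data.List.Membership.DecPropositional as DecMem
open import Relation.Binary.PropositionalEquality using (_≡_; _≢_; refl; cong)
open import Relation.Binary.Definitions using (DecidableEquality)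
open import Relation.Nullary using (yes; no)

-- Graphs: a vertex type with decidable equality and an adjacency relation.
-- (Finiteness is enforced by the existence of an ordering, i.e. a list
-- enumerating every vertex exactly once.)

record Graph : Set₁ where
  field
    V   : Set
    _≟_ : DecidableEquality V
    E   : V → V → Set

open Graph public

IsSimple : Graph → Set
IsSimple G = (∀ u v → E G u v → E G v u) × (∀ v → E G v v → ⊥)

IsOrdering : (G : Graph) → List (V G) → Set
IsOrdering G φ = Unique φ × (∀ v → v ∈ φ)

Precedes : {A : Set} → List A → A → A → Set
Precedes {A} φ a b =
  Σ (List A) λ l₁ → Σ (List A) λ l₂ → Σ (List A) λ l₃ →
    φ ≡ l₁ ++ (a ∷ l₂ ++ (b ∷ l₃))

Between : {A : Set} → List A → A → A → A → Set
Between φ w a b = (Precedes φ a w × Precedes φ w b) ⊎ (Precedes φ b w × Precedes φ w a)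

IsClique : (G : Graph) → ℕ → List (V G) → Set
IsClique G k X =
  Unique X × length X ≡ k × (∀ u v → u ∈ X → v ∈ X → u ≢ v → E G u v)

interSize : (G : Graph) → List (V G) → List (V G) → ℕ
interSize G X Y = length (filter (λ v → v ∈? Y) X)
  where open DecMem (_≟_ G) using (_∈?_)

IsKCEOrdering : (G : Graph) → ℕ → List (V G) → Set
IsKCEOrdering G k φ =
  IsOrdering G φ ×
  (∀ (X Y : List (V G)) (a b : V G) →
     IsClique G k X → IsClique G k Y →
     interSize G X Y ≡ k ∸ 1 →
     (a ∈ X × a ∉ Y × (∀ v → v ∈ X → v ∉ Y → v ≡ a)) →
     (b ∈ Y × b ∉ X × (∀ v → v ∈ Y → v ∉ X → v ≡ b)) →
     (∀ w → w ∈ X → w ∈ Y → Between φ w a b) →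
     E G a b)

-- The gadget Γ_k, with K = {v_1,…,v_{2k-1}} indexed by Fin (2k-1)
-- (0-based: Fin index i stands for v_{i+1}), and u_{i,j} for i < j.

data ΓV (N : ℕ) : Set where
  kv : Fin N → ΓV N
  iv : Fin N → Fin N → ΓV N

-- u_{i,j} is a vertex of Γ_k iff i < j and (i,j) ≠ (v₁,v₂)
is01 : {N : ℕ} → Fin N → Fin N → Bool
is01 zero (suc zero) = true
is01 _    _          = false

-- vertices of Γ_k that are NOT identified with a vertex of G
-- (all of I ∖ {u_{1,2}}, and v_4,…,v_{2k-1})
extra : {N : ℕ} → ΓV N → Bool
extra (kv (suc (suc (suc _)))) = true
extra (kv _)                   = false
extra (iv i j)                 = (toℕ i <ᵇ toℕ j) ∧ not (is01 i j)

inΓ : {N : ℕ} → ΓV N → Bool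
inΓ (kv _)   = true
inΓ (iv i j) = extra (iv i j)

-- adjacency of F_k (restricted to Γ_k via inΓ below)
ΓE : {N : ℕ} → ΓV N → ΓV N → Set
ΓE (kv i)   (kv j)   = i ≢ j
ΓE (kv l)   (iv i j) = l ≢ i × l ≢ j
ΓE (iv i j) (kv l)   = l ≢ i × l ≢ j
ΓE (iv _ _) (iv _ _) = ⊥

ΓV-≟ : {N : ℕ} → DecidableEquality (ΓV N)
ΓV-≟ (kv i) (kv j) with i FinP.≟ j
... | yes refl = yes refl
... | no ne    = no λ { refl → ne refl }
ΓV-≟ (kv _) (iv _ _) = no λ ()
ΓV-≟ (iv _ _) (kv _) = no λ ()
ΓV-≟ (iv i j) (iv i' j') with i FinP.≟ i' | j FinP.≟ j'
... | yes refl | yes refl = yes refl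
... | no ne    | _        = no λ { refl → ne refl }
... | yes _    | no ne    = no λ { refl → ne refl }

T-irr : (b : Bool) (p q : T b) → p ≡ q
T-irr true tt tt = refl

Extra : ℕ → Set
Extra N = Σ (ΓV N) (λ w → T (extra w))

Extra-≟ : {N : ℕ} → DecidableEquality (Extra N)
Extra-≟ (w , p) (w' , p') with ΓV-≟ w w'
... | yes refl = yes (cong (w ,_) (T-irr (extra w) p p'))
... | no ne    = no λ { refl → ne refl }

⊎-≟ : {A B : Set} → DecidableEquality A → DecidableEquality B → DecidableEquality (A ⊎ B)
⊎-≟ dA dB (inj₁ a) (inj₁ a') with dA a a'
... | yes refl = yes refl
... | no ne    = no λ { refl → ne refl }
⊎-≟ dA dB (inj₁ _) (inj₂ _) = no λ ()
⊎-≟ dA dB (inj₂ _) (inj₁ _) = no λ ()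
⊎-≟ dA dB (inj₂ b) (inj₂ b') with dB b b'
... | yes refl = yes refl
... | no ne    = no λ { refl → ne refl }

-- C_k(G,x,y,z): V(G') = V(G) ⊎ (vertices of Γ_k not identified),
-- where v_1 ↦ x, v_3 ↦ y, v_2 ↦ z.

2k-1 : ℕ → ℕ
2k-1 k = 2 * k ∸ 1

liftΓ : {A : Set} (N : ℕ) (x y z : A) → (w : ΓV N) → T (inΓ w) → A ⊎ Extra N
liftΓ N x y z (kv zero)                   _ = inj₁ x
liftΓ N x y z (kv (suc zero))             _ = inj₁ z
liftΓ N x y z (kv (suc (suc zero)))       _ = inj₁ y
liftΓ N x y z (kv (suc (suc (suc i))))    p = inj₂ (kv (suc (suc (suc i))) , p)
liftΓ N x y z (iv i j)                    p = inj₂ (iv i j , p)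

Ck : (G : Graph) (k : ℕ) (x y z : V G) → Graph
Ck G k x y z = record
  { V   = V G ⊎ Extra (2k-1 k)
  ; _≟_ = ⊎-≟ (_≟_ G) Extra-≟
  ; E   = E'
  }
  where
  N = 2k-1 k
  E' : V G ⊎ Extra N → V G ⊎ Extra N → Set
  E' p q =
    (Σ (V G) λ a → Σ (V G) λ b → p ≡ inj₁ a × q ≡ inj₁ b × E G a b)
    ⊎
    (Σ (ΓV N) λ w → Σ (ΓV N) λ w' → Σ (T (inΓ w)) λ pw → Σ (T (inΓ w')) λ pw' →
       ΓE w w' × liftΓ N x y z w pw ≡ p × liftΓ N x y z w' pw' ≡ q)

restrictG : {A B : Set} → List (A ⊎ B) → List A
restrictG = mapMaybe fromInj₁
  where
  fromInj₁ : {A B : Set} → A ⊎ B → Maybe A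
  fromInj₁ (inj₁ a) = just a
  fromInj₁ (inj₂ _) = nothing

-- Order Γ_k by slots: K as v₁, v₃, v₄, …, v_{2k−1}, v₂, with u_{1,j} inserted after the
-- K-vertex of rank k − 2 and every other u_{i,j} after the one of rank k − 1. When
-- x <ψ y <ψ z, let φ be ψ with the new vertices of Γ_k inserted in slot order right after y;
-- φ is then sorted by a key extending the slots (x's slot on G before y, z's slot after y).
-- Let k-cliques X, Y witness the k-C-E condition at a, b. If a, b lie in G and one of them is
-- off the triangle xyz, then X and Y lie in G and the condition is inherited from ψ.
-- Otherwise the k − 1 vertices of X ∩ Y are common neighbours of a and b lying between them,
-- so their keys lie between those of a and b. If one of a, b is some u_{i,j}, the other lies
-- in Γ_k and ab is not an edge, they are K-vertices of distinct ranks in a window of fewer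
-- than k − 1 ranks; if one of a, b is a new vertex and the other is off the triangle, they
-- include y and z, which lie on opposite sides of every new vertex. The case z <ψ y <ψ x
-- follows by reversing both orderings.

module Submission where

open import Defs
open import Data.Nat using (ℕ; _≤_)
open import Data.Product using (Σ; _×_)
open import Data.List using (List)
open import Relation.Binary.PropositionalEquality using (_≡_; _≢_)

open import Data.Nat using (zero; suc; _+_; _∸_; _<_; z≤n; s≤s; ⌊_/2⌋; ⌈_/2⌉)
import Data.Nat as ℕ
open import Data.Nat.Properties
  using ( ≤-refl; ≤-trans; ≤-reflexive; ≤-pred; <⇒≤; <⇒≱; <⇒≢; ≤∧≢⇒<; ≤-<-trans; <-trans; 1+n≰n; _≤?_
        ; n≤1+n; m≤m+n; m≤n+m; m<m+n; +-suc; +-comm; +-monoˡ-≤; +-monoʳ-≤; +-mono-≤; +-mono-<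
        ; m+[n∸m]≡n; m+n∸m≡n; ∸-monoˡ-<; ∸-monoˡ-≤; suc-injective
        ; n≡⌊n+n/2⌋; n≡⌈n+n/2⌉; ⌊n/2⌋-mono; ⌈n/2⌉-mono; module ≤-Reasoning )
open import Data.Nat.Tactic.RingSolver using (solve-∀)
open import Data.Fin using (Fin; zero; suc; toℕ)
import Data.Fin.Properties as Fin
open import Data.Bool using (Bool; T)
open import Data.Unit using (tt)
open import Data.Empty using (⊥; ⊥-elim)
open import Data.Product using (_,_; proj₁; proj₂)
open import Data.Sum using (_⊎_; inj₁; inj₂)
open import Data.Sum.Properties using (inj₁-injective; inj₂-injective)
open import Data.List
  using ([]; _∷_; _++_; [_]; length; map; reverse; filter; concat; applyUpTo; allFin; cartesianProductWith)
open import Data.List.Properties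
  using ( ++-assoc; ++-identityʳ; reverse-++; unfold-reverse; reverse-involutive
        ; length-++; length-map; length-applyUpTo )
open import Data.List.Relation.Unary.All as All using (All; []; _∷_)
import Data.List.Relation.Unary.All.Properties as All
open import Data.List.Relation.Unary.Any using (here; there)
import Data.List.Relation.Unary.Any.Properties as Any
open import Data.List.Relation.Unary.AllPairs using (AllPairs; []; _∷_)
import Data.List.Relation.Unary.AllPairs.Properties as AllPairs
open import Data.List.Relation.Unary.Unique.Propositional using (Unique)
import Data.List.Relation.Unary.Unique.Propositional.Properties as Unique
open import Data.List.Membership.Propositional using (_∈_; _∉_)
open import Data.List.Membership.Propositional.Properties
import Data.List.Membership.DecPropositional as DecMembership
open import Data.List.Relation.Binary.Subset.Propositional using (_⊆_)
open import Data.List.Relation.Binary.Permutation.Propositional using (↭-sym; ↭⇒↭ₛ)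
open import Data.List.Relation.Binary.Permutation.Propositional.Properties using (↭-reverse)
import Data.List.Relation.Binary.Permutation.Setoid.Properties as Permutation
open import Function using (_∘_; _on_)
open import Relation.Binary.Definitions using (DecidableEquality)
open import Relation.Binary.PropositionalEquality
  using (refl; sym; trans; cong; subst; subst₂; setoid; module ≡-Reasoning)
open import Relation.Nullary using (Dec; yes; no; ¬_)
open import Relation.Nullary.Decidable using (T?)

private variable
  A B : Set
  a b c w : A
  xs ys φ : List A

-- Counting the elements of duplicate-free lists

∈-delete : ∀ ys₁ {ys₂} → a ∈ ys₁ ++ b ∷ ys₂ → a ≢ b → a ∈ ys₁ ++ ys₂
∈-delete ys₁ a∈ a≢b with ∈-++⁻ ys₁ a∈
... | inj₁ a∈ys₁         = ∈-++⁺ˡ a∈ys₁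
... | inj₂ (here a≡b)    = ⊥-elim (a≢b a≡b)
... | inj₂ (there a∈ys₂) = ∈-++⁺ʳ ys₁ a∈ys₂

length-delete : ∀ (ys₁ : List A) {ys₂} → length (ys₁ ++ b ∷ ys₂) ≡ suc (length (ys₁ ++ ys₂))
length-delete ys₁ {ys₂} = begin
  length (ys₁ ++ _ ∷ ys₂)          ≡⟨ length-++ ys₁ ⟩
  length ys₁ + suc (length ys₂)    ≡⟨ +-suc (length ys₁) (length ys₂) ⟩
  suc (length ys₁ + length ys₂)    ≡⟨ cong suc (sym (length-++ ys₁)) ⟩
  suc (length (ys₁ ++ ys₂))        ∎
  where open ≡-Reasoning

InjectiveOn : (A → B) → List A → Set
InjectiveOn f xs = ∀ {a b} → a ∈ xs → b ∈ xs → f a ≡ f b → a ≡ b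

length-≤-injection : (f : A → B) → Unique xs → InjectiveOn f xs →
  (∀ {a} → a ∈ xs → f a ∈ ys) → length xs ≤ length ys
length-≤-injection {xs = []} f _ _ _ = z≤n
length-≤-injection {xs = x ∷ xs} f (x∉ ∷ uxs) inj into with ∈-∃++ (into (here refl))
... | ys₁ , ys₂ , refl =
  ≤-trans (s≤s (length-≤-injection f uxs (λ p q → inj (there p) (there q)) into′))
          (≤-reflexive (sym (length-delete ys₁)))
  where
  into′ : ∀ {a} → a ∈ xs → f a ∈ ys₁ ++ ys₂
  into′ a∈ = ∈-delete ys₁ (into (there a∈))
    (λ fa≡fx → All.lookup x∉ a∈ (sym (inj (there a∈) (here refl) fa≡fx)))

length-≤-⊆ : Unique xs → xs ⊆ ys → length xs ≤ length ys
length-≤-⊆ uxs = length-≤-injection (λ a → a) uxs (λ _ _ eq → eq)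

length-<-missing : Unique xs → xs ⊆ ys → a ∈ ys → a ∉ xs → length xs < length ys
length-<-missing {ys = ys} uxs xs⊆ys a∈ys a∉xs with ∈-∃++ a∈ys
... | ys₁ , ys₂ , refl =
  ≤-trans (s≤s (length-≤-⊆ uxs (λ v∈ → ∈-delete ys₁ (xs⊆ys v∈) λ { refl → a∉xs v∈ })))
          (≤-reflexive (sym (length-delete ys₁)))

length-≤-interval : (f : A → ℕ) {lo hi : ℕ} → Unique xs → InjectiveOn f xs →
  (∀ {a} → a ∈ xs → lo ≤ f a × f a < hi) → length xs ≤ hi ∸ lo
length-≤-interval f {lo} {hi} uxs inj bounds =
  ≤-trans (length-≤-injection f uxs inj into) (≤-reflexive (length-applyUpTo (lo +_) (hi ∸ lo)))
  where
  into : ∀ {a} → a ∈ _ → f a ∈ applyUpTo (lo +_) (hi ∸ lo)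
  into a∈ with bounds a∈
  ... | lo≤ , <hi = subst (_∈ _) (m+[n∸m]≡n lo≤) (∈-applyUpTo⁺ (lo +_) (∸-monoˡ-< <hi lo≤))

-- Precedence, betweenness and sortedness

reverse-++-∷ : (xs : List A) → reverse (xs ++ a ∷ ys) ≡ reverse ys ++ a ∷ reverse xs
reverse-++-∷ {a = a} {ys = ys} xs = begin
  reverse (xs ++ a ∷ ys)           ≡⟨ reverse-++ xs (a ∷ ys) ⟩
  reverse (a ∷ ys) ++ reverse xs   ≡⟨ cong (_++ reverse xs) (unfold-reverse a ys) ⟩
  (reverse ys ++ [ a ]) ++ reverse xs ≡⟨ ++-assoc (reverse ys) [ a ] (reverse xs) ⟩
  reverse ys ++ a ∷ reverse xs     ∎
  where open ≡-Reasoning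

Precedes-reverse : Precedes φ a b → Precedes (reverse φ) b a
Precedes-reverse {a = a} {b = b} (l₁ , l₂ , l₃ , refl) = reverse l₃ , reverse l₂ , reverse l₁ , (begin
  reverse (l₁ ++ a ∷ l₂ ++ b ∷ l₃)                 ≡⟨ reverse-++-∷ l₁ ⟩
  reverse (l₂ ++ b ∷ l₃) ++ a ∷ reverse l₁         ≡⟨ cong (_++ a ∷ reverse l₁) (reverse-++-∷ l₂) ⟩
  (reverse l₃ ++ b ∷ reverse l₂) ++ a ∷ reverse l₁ ≡⟨ ++-assoc (reverse l₃) _ _ ⟩
  reverse l₃ ++ b ∷ reverse l₂ ++ a ∷ reverse l₁   ∎)
  where open ≡-Reasoning

Between-reverse : Between φ w a b → Between (reverse φ) w a b
Between-reverse (inj₁ (a<w , w<b)) = inj₂ (Precedes-reverse w<b , Precedes-reverse a<w)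
Between-reverse (inj₂ (b<w , w<a)) = inj₁ (Precedes-reverse w<a , Precedes-reverse b<w)

Between-reverse⁻ : Between (reverse φ) w a b → Between φ w a b
Between-reverse⁻ {φ = φ} {w = w} {a = a} {b = b} =
  subst (λ ψ → Between ψ w a b) (reverse-involutive φ) ∘ Between-reverse

Between-sym : Between φ w a b → Between φ w b a
Between-sym (inj₁ p) = inj₂ p
Between-sym (inj₂ p) = inj₁ p

Unique-reverse : Unique xs → Unique (reverse xs)
Unique-reverse {xs = xs} = Permutation.Unique-resp-↭ (setoid _) (↭⇒↭ₛ (↭-sym (↭-reverse xs)))

Precedes-∷ : Precedes (c ∷ φ) a b → a ≢ c → Precedes φ a b
Precedes-∷ ([]     , _  , _  , refl) a≢a = ⊥-elim (a≢a refl)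
Precedes-∷ (_ ∷ l₁ , l₂ , l₃ , refl) _   = l₁ , l₂ , l₃ , refl

Precedes-head : Unique (a ∷ φ) → Precedes (a ∷ φ) a b → b ∈ φ
Precedes-head _           ([]     , l₂ , _ , refl) = ∈-++⁺ʳ l₂ (here refl)
Precedes-head (a∉ ∷ _)    (_ ∷ l₁ , _  , _ , refl) = ⊥-elim (All.lookup a∉ (∈-++⁺ʳ l₁ (here refl)) refl)

Precedes-after : ∀ (xs : List A) → Unique (xs ++ a ∷ ys) → Precedes (xs ++ a ∷ ys) a b → b ∈ ys
Precedes-after []       u         a<b = Precedes-head u a<b
Precedes-after (c ∷ xs) (c∉ ∷ u) a<b =
  Precedes-after xs u (Precedes-∷ a<b λ { refl → All.lookup c∉ (∈-++⁺ʳ xs (here refl)) refl })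

SortedBy : (A → ℕ) → List A → Set
SortedBy f = AllPairs (_≤_ on f)

AllPairs-++⁻ʳ : {R : A → A → Set} (xs : List A) → AllPairs R (xs ++ ys) → AllPairs R ys
AllPairs-++⁻ʳ []       p       = p
AllPairs-++⁻ʳ (_ ∷ xs) (_ ∷ p) = AllPairs-++⁻ʳ xs p

Precedes-sortedBy : {f : A → ℕ} → SortedBy f φ → Precedes φ a b → f a ≤ f b
Precedes-sortedBy s (l₁ , l₂ , _ , refl) with AllPairs-++⁻ʳ l₁ s
... | a≤ ∷ _ = All.lookup a≤ (∈-++⁺ʳ l₂ (here refl))

Unique-++⇒disjoint : (xs : List A) → Unique (xs ++ ys) → a ∈ xs → a ∉ ys
Unique-++⇒disjoint (_ ∷ xs) (a∉ ∷ _) (here refl) a∈ys = All.lookup a∉ (∈-++⁺ʳ xs a∈ys) refl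
Unique-++⇒disjoint (_ ∷ xs) (_ ∷ u)  (there a∈)  a∈ys = Unique-++⇒disjoint xs u a∈ a∈ys

Between-sortedBy : {f : A → ℕ} → SortedBy f φ → Between φ w a b →
  (f a ≤ f w × f w ≤ f b) ⊎ (f b ≤ f w × f w ≤ f a)
Between-sortedBy s (inj₁ (a<w , w<b)) = inj₁ (Precedes-sortedBy s a<w , Precedes-sortedBy s w<b)
Between-sortedBy s (inj₂ (b<w , w<a)) = inj₂ (Precedes-sortedBy s b<w , Precedes-sortedBy s w<a)

Between-sortedBy-below : {f : A → ℕ} → SortedBy f φ → Between φ w a b → f w < f a → f b ≤ f w
Between-sortedBy-below s bt w<a with Between-sortedBy s bt
... | inj₁ (a≤w , _) = ⊥-elim (<⇒≱ w<a a≤w)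
... | inj₂ (b≤w , _) = b≤w

Between-sortedBy-above : {f : A → ℕ} → SortedBy f φ → Between φ w a b → f a < f w → f w ≤ f b
Between-sortedBy-above s bt a<w with Between-sortedBy s bt
... | inj₁ (_ , w≤b) = w≤b
... | inj₂ (_ , w≤a) = ⊥-elim (<⇒≱ a<w w≤a)

sortedBy-++ : {f : A → ℕ} {t : ℕ} → SortedBy f xs → SortedBy f ys →
  All (λ a → f a ≤ t) xs → All (λ b → t ≤ f b) ys → SortedBy f (xs ++ ys)
sortedBy-++ sxs sys xs≤t t≤ys =
  AllPairs.++⁺ sxs sys (All.map (λ a≤t → All.map (≤-trans a≤t) t≤ys) xs≤t)

sortedBy-const : {f : A → ℕ} {n : ℕ} → All (λ a → f a ≡ n) xs → SortedBy f xs
sortedBy-const []         = []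
sortedBy-const (fa ∷ fxs) = All.map (λ fb → ≤-reflexive (trans fa (sym fb))) fxs ∷ sortedBy-const fxs

-- Enumerations

module BucketSort (f : A → ℕ) (n : ℕ) where

  bucket : ℕ → List A → List A
  bucket i = filter (λ a → f a ℕ.≟ i)

  bucketSort : List A → List A
  bucketSort xs = concat (applyUpTo (λ i → bucket i xs) n)

  ∈-bucketSort⁺ : a ∈ xs → f a < n → a ∈ bucketSort xs
  ∈-bucketSort⁺ a∈ fa<n = ∈-concat⁺′ (∈-filter⁺ (λ a → f a ℕ.≟ _) a∈ refl) (∈-applyUpTo⁺ _ fa<n)

  key-bucket : ∀ {i} xs → a ∈ bucket i xs → f a ≡ i
  key-bucket xs a∈ = proj₂ (∈-filter⁻ (λ a → f a ℕ.≟ _) {xs = xs} a∈)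

  bucketSort-unique : Unique xs → Unique (bucketSort xs)
  bucketSort-unique {xs = xs} uxs = Unique.concat⁺
    (All.applyUpTo⁺₂ _ n λ _ → Unique.filter⁺ _ uxs)
    (AllPairs.applyUpTo⁺₁ _ n λ i<j _ (a∈i , a∈j) →
       <⇒≢ i<j (trans (sym (key-bucket xs a∈i)) (key-bucket xs a∈j)))

  bucketSort-sorted : SortedBy f (bucketSort xs)
  bucketSort-sorted {xs = xs} = AllPairs.concat⁺
    (All.applyUpTo⁺₂ _ n λ i → sortedBy-const (All.all-filter _ xs))
    (AllPairs.applyUpTo⁺₁ _ n λ i<j _ → All.tabulate λ a∈ → All.tabulate λ b∈ →
       subst₂ _≤_ (sym (key-bucket xs a∈)) (sym (key-bucket xs b∈)) (<⇒≤ i<j))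

module Select (p : A → Bool) where

  select : List A → List (Σ A (T ∘ p))
  select []       = []
  select (a ∷ as) with T? (p a)
  ... | yes pa = (a , pa) ∷ select as
  ... | no  _  = select as

  select-⊆ : ∀ {e} as → e ∈ select as → proj₁ e ∈ as
  select-⊆ (a ∷ as) e∈ with T? (p a) | e∈
  ... | yes _ | here refl = here refl
  ... | yes _ | there e∈′ = there (select-⊆ as e∈′)
  ... | no  _ | e∈′       = there (select-⊆ as e∈′)

  ∈-select⁺ : ∀ {as} → a ∈ as → (pa : T (p a)) → (a , pa) ∈ select as
  ∈-select⁺ {a = a} {as = b ∷ as} a∈ pa with T? (p b) | a∈
  ... | yes pb  | here refl = here (cong (a ,_) (T-irr (p a) pa pb))
  ... | no  ¬pb | here refl = ⊥-elim (¬pb pa)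
  ... | yes _   | there a∈′ = there (∈-select⁺ a∈′ pa)
  ... | no  _   | there a∈′ = ∈-select⁺ a∈′ pa

  select-unique : ∀ {as} → Unique as → Unique (select as)
  select-unique {as = []}     _          = []
  select-unique {as = a ∷ as} (a∉ ∷ uas) with T? (p a)
  ... | yes _ = All.tabulate (λ e∈ eq → All.lookup a∉ (select-⊆ as e∈) (cong proj₁ eq)) ∷ select-unique uas
  ... | no  _ = select-unique uas

-- Orderings of a disjoint union

restrictG-++ : (φ φ′ : List (A ⊎ B)) → restrictG (φ ++ φ′) ≡ restrictG φ ++ restrictG φ′
restrictG-++ []           φ′ = refl
restrictG-++ (inj₁ a ∷ φ) φ′ = cong (a ∷_) (restrictG-++ φ φ′)
restrictG-++ (inj₂ _ ∷ φ) φ′ = restrictG-++ φ φ′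

restrictG-reverse : (φ : List (A ⊎ B)) → restrictG (reverse φ) ≡ reverse (restrictG φ)
restrictG-reverse []      = refl
restrictG-reverse (v ∷ φ) = begin
  restrictG (reverse (v ∷ φ))                ≡⟨ cong restrictG (unfold-reverse v φ) ⟩
  restrictG (reverse φ ++ [ v ])             ≡⟨ restrictG-++ (reverse φ) [ v ] ⟩
  restrictG (reverse φ) ++ restrictG [ v ]   ≡⟨ cong (_++ restrictG [ v ]) (restrictG-reverse φ) ⟩
  reverse (restrictG φ) ++ restrictG [ v ]   ≡⟨ last v ⟩
  reverse (restrictG (v ∷ φ))                ∎
  where
  open ≡-Reasoning
  last : ∀ v → reverse (restrictG φ) ++ restrictG [ v ] ≡ reverse (restrictG (v ∷ φ))
  last (inj₁ a) = sym (unfold-reverse a (restrictG φ))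
  last (inj₂ _) = ++-identityʳ (reverse (restrictG φ))

Precedes-restrictG : {φ : List (A ⊎ B)} → Precedes φ (inj₁ a) (inj₁ b) → Precedes (restrictG φ) a b
Precedes-restrictG {a = a} {b = b} (l₁ , l₂ , l₃ , refl) = restrictG l₁ , restrictG l₂ , restrictG l₃ , (begin
  restrictG (l₁ ++ inj₁ a ∷ l₂ ++ inj₁ b ∷ l₃)             ≡⟨ restrictG-++ l₁ _ ⟩
  restrictG l₁ ++ a ∷ restrictG (l₂ ++ inj₁ b ∷ l₃)
    ≡⟨ cong (λ t → restrictG l₁ ++ a ∷ t) (restrictG-++ l₂ _) ⟩
  restrictG l₁ ++ a ∷ restrictG l₂ ++ b ∷ restrictG l₃    ∎)
  where open ≡-Reasoning

Between-restrictG : {φ : List (A ⊎ B)} → Between φ (inj₁ w) (inj₁ a) (inj₁ b) → Between (restrictG φ) w a b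
Between-restrictG (inj₁ (p , q)) = inj₁ (Precedes-restrictG p , Precedes-restrictG q)
Between-restrictG (inj₂ (p , q)) = inj₂ (Precedes-restrictG p , Precedes-restrictG q)

∈-restrictG⁺ : {φ : List (A ⊎ B)} → inj₁ a ∈ φ → a ∈ restrictG φ
∈-restrictG⁺ {φ = inj₁ _ ∷ _} (here refl) = here refl
∈-restrictG⁺ {φ = inj₁ _ ∷ _} (there a∈)  = there (∈-restrictG⁺ a∈)
∈-restrictG⁺ {φ = inj₂ _ ∷ _} (there a∈)  = ∈-restrictG⁺ a∈

splice : List A → List B → List A → List (A ⊎ B)
splice xs zs ys = map inj₁ xs ++ map inj₂ zs ++ map inj₁ ys

restrictG-splice : (xs : List A) (zs : List B) (ys : List A) → restrictG (splice xs zs ys) ≡ xs ++ ys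
restrictG-splice (a ∷ xs) zs ys = cong (a ∷_) (restrictG-splice xs zs ys)
restrictG-splice []       []       ys = restrictG-map ys
  where
  restrictG-map : (ys : List A) → restrictG (map (inj₁ {B = B}) ys) ≡ ys
  restrictG-map []       = refl
  restrictG-map (a ∷ ys) = cong (a ∷_) (restrictG-map ys)
restrictG-splice []       (_ ∷ zs) ys = restrictG-splice [] zs ys

∈-splice : (xs : List A) {zs : List B} {ys : List A} → (∀ a → a ∈ xs ++ ys) → (∀ c → c ∈ zs) →
  ∀ v → v ∈ splice xs zs ys
∈-splice xs all∈ _ (inj₁ a) with ∈-++⁻ xs (all∈ a)
... | inj₁ a∈xs = ∈-++⁺ˡ (∈-map⁺ inj₁ a∈xs)
... | inj₂ a∈ys = ∈-++⁺ʳ (map inj₁ xs) (∈-++⁺ʳ _ (∈-map⁺ inj₁ a∈ys))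
∈-splice xs _ all∈ (inj₂ c) = ∈-++⁺ʳ (map inj₁ xs) (∈-++⁺ˡ (∈-map⁺ inj₂ (all∈ c)))

Unique-splice : (xs : List A) {zs : List B} {ys : List A} → Unique (xs ++ ys) → Unique zs →
  Unique (splice xs zs ys)
Unique-splice (a ∷ xs) {zs} {ys} (a∉ ∷ u) uzs =
  All.tabulate (λ { v∈ refl → All.lookup a∉ (a∈ v∈) refl }) ∷ Unique-splice xs u uzs
  where
  a∈ : inj₁ a ∈ splice xs zs ys → a ∈ xs ++ ys
  a∈ = subst (a ∈_) (restrictG-splice xs zs ys) ∘ ∈-restrictG⁺
Unique-splice [] uys uzs = Unique.++⁺ (Unique.map⁺ inj₂-injective uzs) (Unique.map⁺ inj₁-injective uys) disjoint
  where
  disjoint : ∀ {v} → ¬ (v ∈ map inj₂ _ × v ∈ map inj₁ _)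
  disjoint (v∈ , v∈′) with ∈-map⁻ inj₂ v∈ | ∈-map⁻ inj₁ v∈′
  ... | _ , _ , refl | _ , _ , ()

-- Clique-extendible orderings

_∖_≐_ : List A → List A → A → Set
X ∖ Y ≐ a = a ∈ X × a ∉ Y × (∀ v → v ∈ X → v ∉ Y → v ≡ a)

record Configuration (G : Graph) (k : ℕ) (φ : List (V G)) (a b : V G) : Set where
  constructor configuration
  field
    X Y      : List (V G)
    clique-X : IsClique G k X
    clique-Y : IsClique G k Y
    size-X∩Y : interSize G X Y ≡ k ∸ 1
    X∖Y≐a    : X ∖ Y ≐ a
    Y∖X≐b    : Y ∖ X ≐ b
    between  : ∀ w → w ∈ X → w ∈ Y → Between φ w a b

Extendible : (G : Graph) → ℕ → List (V G) → Set
Extendible G k φ = ∀ {a b} → Configuration G k φ a b → E G a b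

IsKCEOrdering⇒Extendible : ∀ {G k φ} → IsKCEOrdering G k φ → Extendible G k φ
IsKCEOrdering⇒Extendible (_ , ext) (configuration X Y cX cY o da db bt) = ext X Y _ _ cX cY o da db bt

Extendible⇒IsKCEOrdering : ∀ {G k φ} → IsOrdering G φ → Extendible G k φ → IsKCEOrdering G k φ
Extendible⇒IsKCEOrdering ord ext = ord , λ X Y a b cX cY o da db bt → ext (configuration X Y cX cY o da db bt)

IsKCEOrdering-reverse : ∀ {G k φ} → IsKCEOrdering G k φ → IsKCEOrdering G k (reverse φ)
IsKCEOrdering-reverse kce@((uφ , all∈) , _) =
  Extendible⇒IsKCEOrdering (Unique-reverse uφ , Any.reverse⁺ ∘ all∈)
    λ (configuration X Y cX cY s da db bt) → IsKCEOrdering⇒Extendible kce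
      (configuration X Y cX cY s da db λ w w∈X w∈Y → Between-reverse⁻ (bt w w∈X w∈Y))

Configuration-≢ : ∀ {G k φ a b} → Configuration G k φ a b → a ≢ b
Configuration-≢ cfg refl = proj₁ (proj₂ (Configuration.X∖Y≐a cfg)) (proj₁ (Configuration.Y∖X≐b cfg))

-- X ∩ Y in the k-C-E condition: n common neighbours of a and b, all lying between them.
record Link (G : Graph) (φ : List (V G)) (n : ℕ) (a b : V G) : Set where
  field
    common    : List (V G)
    unique    : Unique common
    size      : length common ≡ n
    adjacentˡ : ∀ {w} → w ∈ common → E G w a
    adjacentʳ : ∀ {w} → w ∈ common → E G w b
    betweenᶜ  : ∀ {w} → w ∈ common → Between φ w a b
    distinctˡ : ∀ {w} → w ∈ common → w ≢ a
    distinctʳ : ∀ {w} → w ∈ common → w ≢ b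

Link-swap : ∀ {G φ n a b} → Link G φ n a b → Link G φ n b a
Link-swap L = record
  { common = common ; unique = unique ; size = size
  ; adjacentˡ = adjacentʳ ; adjacentʳ = adjacentˡ
  ; betweenᶜ = Between-sym ∘ betweenᶜ
  ; distinctˡ = distinctʳ ; distinctʳ = distinctˡ
  }
  where open Link L

Configuration⇒Link : ∀ {G k φ a b} → Configuration G k φ a b → Link G φ (k ∸ 1) a b
Configuration⇒Link {G} {a = a} {b}
  (configuration X Y (uX , _ , adjX) (_ , _ , adjY) s (a∈X , a∉Y , _) (b∈Y , b∉X , _) bt) = record
  { common    = X∩Y
  ; unique    = Unique.filter⁺ (_∈? Y) uX
  ; size      = s
  ; adjacentˡ = λ w∈ → adjX _ a (∈X w∈) a∈X (w≢a w∈)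
  ; adjacentʳ = λ w∈ → adjY _ b (∈Y w∈) b∈Y (w≢b w∈)
  ; betweenᶜ  = λ w∈ → bt _ (∈X w∈) (∈Y w∈)
  ; distinctˡ = w≢a
  ; distinctʳ = w≢b
  }
  where
  open DecMembership (_≟_ G) using (_∈?_)
  X∩Y = filter (_∈? Y) X
  ∈X : ∀ {w} → w ∈ X∩Y → w ∈ X
  ∈X w∈ = proj₁ (∈-filter⁻ (_∈? Y) {xs = X} w∈)
  ∈Y : ∀ {w} → w ∈ X∩Y → w ∈ Y
  ∈Y w∈ = proj₂ (∈-filter⁻ (_∈? Y) {xs = X} w∈)
  w≢a : ∀ {w} → w ∈ X∩Y → w ≢ a
  w≢a w∈ refl = a∉Y (∈Y w∈)
  w≢b : ∀ {w} → w ∈ X∩Y → w ≢ b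
  w≢b w∈ refl = b∉X (∈X w∈)

-- The gluing C_k(G, x, y, z)

module Gluing (G : Graph) (simple : IsSimple G) (k′ : ℕ) {x y z : V G}
  (xy : E G x y) (yz : E G y z) (xz : E G x z) where

  k : ℕ
  k = 4 + k′

  N : ℕ
  N = 2k-1 k

  G′ : Graph
  G′ = Ck G k x y z

  V′ : Set
  V′ = V G′

  E′ : V′ → V′ → Set
  E′ = E G′

  _≟ᴳ_ : DecidableEquality (V G)
  _≟ᴳ_ = Graph._≟_ G

  vK : Fin N → V′
  vK l = liftΓ N x y z (kv l) tt

  vI : (i j : Fin N) → T (extra (iv i j)) → V′
  vI i j p = inj₂ (iv i j , p)

  -- Fin index l stands for v_{l+1}; ranks list K as v₁, v₃, v₄, …, v_{2k−1}, v₂.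
  rank : Fin N → ℕ
  rank zero          = 0
  rank (suc zero)    = N ∸ 1
  rank (suc (suc l)) = suc (toℕ l)

  rank-ss< : (l : Fin _) → rank (suc (suc l)) < N ∸ 1
  rank-ss< l = s≤s (Fin.toℕ<n l)

  rank-injective : ∀ {l m} → rank l ≡ rank m → l ≡ m
  rank-injective {zero}        {zero}        _  = refl
  rank-injective {suc zero}    {suc zero}    _  = refl
  rank-injective {suc (suc l)} {suc (suc m)} eq = cong (λ l → suc (suc l)) (Fin.toℕ-injective (suc-injective eq))
  rank-injective {suc zero}    {suc (suc m)} eq = ⊥-elim (<⇒≢ (rank-ss< m) (sym eq))
  rank-injective {suc (suc l)} {suc zero}    eq = ⊥-elim (<⇒≢ (rank-ss< l) eq)
  rank-injective {zero} {suc zero}    ()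
  rank-injective {zero} {suc (suc _)} ()
  rank-injective {suc zero}    {zero} ()
  rank-injective {suc (suc _)} {zero} ()

  N∸1≡ : N ∸ 1 ≡ (3 + k′) + (3 + k′)
  N∸1≡ = normal k′
    where
    -- the normal form of 2 * (4 + n) ∸ 2
    normal : ∀ n → 2 + (n + (4 + (n + 0))) ≡ (3 + n) + (3 + n)
    normal = solve-∀

  -- The K-vertex of rank r has slot 2r and u_{i,j} has slot 2 hU i + 1, right after the
  -- K-vertex of rank hU i; ⌊_/2⌋ and ⌈_/2⌉ of a slot recover ranks.
  hU : Fin N → ℕ
  hU zero    = 2 + k′
  hU (suc _) = 3 + k′

  slot : ΓV N → ℕ
  slot (kv l)   = rank l + rank l
  slot (iv i _) = suc (hU i + hU i)

  hU-bounds : ∀ i → 2 + k′ ≤ hU i × hU i ≤ 3 + k′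
  hU-bounds zero    = ≤-refl , n≤1+n _
  hU-bounds (suc _) = n≤1+n _ , ≤-refl

  hU<N∸1 : ∀ i → hU i < N ∸ 1
  hU<N∸1 i = ≤-<-trans (proj₂ (hU-bounds i)) (subst (3 + k′ <_) (sym N∸1≡) (m<m+n (3 + k′) (s≤s z≤n)))

  top : ℕ
  top = slot (kv (suc zero))

  slot-extra : (e : Extra N) → 2 < slot (proj₁ e) × slot (proj₁ e) < top
  slot-extra (kv (suc (suc (suc l))) , _) =
    s≤s (s≤s (≤-trans (s≤s z≤n) (m≤n+m _ (toℕ l)))) , +-mono-< (rank-ss< (suc l)) (rank-ss< (suc l))
  slot-extra (iv i _ , _) =
    s≤s (≤-trans (≤-trans (m≤m+n 2 k′) (proj₁ (hU-bounds i))) (m≤m+n _ _)) ,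
    subst (_≤ top) (cong suc (+-suc (hU i) (hU i))) (+-mono-≤ (hU<N∸1 i) (hU<N∸1 i))

  -- Fewer than k − 1 ranks lie strictly between rank r and the slot right after rank h.
  -- This fails for u_{1,2} and v₂, which is why u_{1,2} is deleted.
  Near : ℕ → ℕ → Set
  Near h r = h ≤ r + (2 + k′) × r ≤ h + (3 + k′)

  near-suc : ∀ l → Near (3 + k′) (rank (suc l))
  near-suc zero    = +-monoˡ-≤ (2 + k′) {1} {N ∸ 1} (s≤s z≤n) , ≤-reflexive N∸1≡
  near-suc (suc l) = +-monoˡ-≤ (2 + k′) (s≤s z≤n) , ≤-trans (<⇒≤ (rank-ss< l)) (≤-reflexive N∸1≡)

  near-i : ∀ i j → T (extra (iv i j)) → Near (hU i) (rank i)
  near-i zero    _ _ = ≤-refl , z≤n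
  near-i (suc i) _ _ = near-suc i

  near-j : ∀ i j → T (extra (iv i j)) → Near (hU i) (rank j)
  near-j zero    (suc (suc j)) _ =
    m≤n+m (2 + k′) (rank (suc (suc j))) , ≤-pred (subst (rank (suc (suc j)) <_) N∸1≡ (rank-ss< j))
  near-j (suc i) (suc j)       _ = near-suc j

  OnTriangle : V G → Set
  OnTriangle g = g ≡ x ⊎ g ≡ y ⊎ g ≡ z

  OffTriangle : V G → Set
  OffTriangle g = g ≢ x × g ≢ y × g ≢ z

  IsK : V′ → Set
  IsK v = Σ (Fin N) λ l → v ≡ vK l

  InG : V′ → Set
  InG v = Σ (V G) λ g → v ≡ inj₁ g

  E⇒E′ : ∀ {a b} → E G a b → E′ (inj₁ a) (inj₁ b)
  E⇒E′ e = inj₁ (_ , _ , refl , refl , e)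

  E′-sym : ∀ {u v} → E′ u v → E′ v u
  E′-sym (inj₁ (a , b , refl , refl , e)) = E⇒E′ (proj₁ simple a b e)
  E′-sym (inj₂ (kv _   , kv _   , p , q , l≢m , eu , ev)) = inj₂ (_ , _ , q , p , (λ eq → l≢m (sym eq)) , ev , eu)
  E′-sym (inj₂ (kv _   , iv _ _ , p , q , ne , eu , ev)) = inj₂ (_ , _ , q , p , ne , ev , eu)
  E′-sym (inj₂ (iv _ _ , kv _   , p , q , ne , eu , ev)) = inj₂ (_ , _ , q , p , ne , ev , eu)

  lift-onTriangle : ∀ w p {g} → liftΓ N x y z w p ≡ inj₁ g → OnTriangle g
  lift-onTriangle (kv zero)             _ refl = inj₁ refl
  lift-onTriangle (kv (suc zero))       _ refl = inj₂ (inj₂ refl)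
  lift-onTriangle (kv (suc (suc zero))) _ refl = inj₂ (inj₁ refl)

  triangle-edge : ∀ {a b} → OnTriangle a → OnTriangle b → a ≢ b → E G a b
  triangle-edge (inj₁ refl)        (inj₂ (inj₁ refl)) _ = xy
  triangle-edge (inj₁ refl)        (inj₂ (inj₂ refl)) _ = xz
  triangle-edge (inj₂ (inj₁ refl)) (inj₂ (inj₂ refl)) _ = yz
  triangle-edge (inj₂ (inj₁ refl)) (inj₁ refl)        _ = proj₁ simple _ _ xy
  triangle-edge (inj₂ (inj₂ refl)) (inj₁ refl)        _ = proj₁ simple _ _ xz
  triangle-edge (inj₂ (inj₂ refl)) (inj₂ (inj₁ refl)) _ = proj₁ simple _ _ yz
  triangle-edge (inj₁ refl)        (inj₁ refl)        a≢a = ⊥-elim (a≢a refl)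
  triangle-edge (inj₂ (inj₁ refl)) (inj₂ (inj₁ refl)) a≢a = ⊥-elim (a≢a refl)
  triangle-edge (inj₂ (inj₂ refl)) (inj₂ (inj₂ refl)) a≢a = ⊥-elim (a≢a refl)

  E′⇒E : ∀ {a b} → E′ (inj₁ a) (inj₁ b) → a ≢ b → E G a b
  E′⇒E (inj₁ (_ , _ , refl , refl , e))       _   = e
  E′⇒E (inj₂ (w , w′ , p , p′ , _ , ea , eb)) a≢b =
    triangle-edge (lift-onTriangle w p ea) (lift-onTriangle w′ p′ eb) a≢b

  adjacent-vI⇒K : ∀ {v i j p} → E′ v (vI i j p) → IsK v
  adjacent-vI⇒K (inj₂ (kv l   , iv _ _ , _ , _ , _  , refl , _)) = l , refl
  adjacent-vI⇒K (inj₂ (_      , kv (suc (suc (suc _))) , _ , _ , _ , _ , ()))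
  adjacent-vI⇒K (inj₂ (iv _ _ , iv _ _ , _ , _ , () , _ , _))

  adjacent-off⇒G : ∀ {v g} → OffTriangle g → E′ v (inj₁ g) → InG v
  adjacent-off⇒G _ (inj₁ (a , _ , refl , refl , _)) = a , refl
  adjacent-off⇒G (≢x , ≢y , ≢z) (inj₂ (_ , w′ , _ , p′ , _ , _ , eg)) with lift-onTriangle w′ p′ eg
  ... | inj₁ g≡x          = ⊥-elim (≢x g≡x)
  ... | inj₂ (inj₁ g≡y)   = ⊥-elim (≢y g≡y)
  ... | inj₂ (inj₂ g≡z)   = ⊥-elim (≢z g≡z)

  adjacent-extra⇒onTriangle : ∀ {g e} → E′ (inj₁ g) (inj₂ e) → OnTriangle g
  adjacent-extra⇒onTriangle (inj₂ (w , _ , p , _ , _ , eg , _)) = lift-onTriangle w p eg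

  data View : V′ → Set where
    viewK : ∀ l → View (vK l)
    viewI : ∀ i j p → View (vI i j p)
    viewG : ∀ g → OffTriangle g → View (inj₁ g)

  view : ∀ v → View v
  view (inj₁ g) with g ≟ᴳ x | g ≟ᴳ y | g ≟ᴳ z
  ... | yes refl | _        | _        = viewK zero
  ... | no _     | yes refl | _        = viewK (suc (suc zero))
  ... | no _     | no _     | yes refl = viewK (suc zero)
  ... | no ≢x    | no ≢y    | no ≢z    = viewG g (≢x , ≢y , ≢z)
  view (inj₂ (kv (suc (suc (suc l))) , _)) = viewK (suc (suc (suc l)))
  view (inj₂ (iv i j , p))                 = viewI i j p

  ∈-map-inj₁⁻ : ∀ {a : V G} {X′} → inj₁ a ∈ map (inj₁ {B = Extra N}) X′ → a ∈ X′
  ∈-map-inj₁⁻ a∈ with ∈-map⁻ inj₁ a∈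
  ... | _ , a∈′ , refl = a∈′

  unmap : (Z : List V′) → (∀ {v} → v ∈ Z → InG v) → Σ (List (V G)) λ Z′ → Z ≡ map inj₁ Z′
  unmap []      _   = [] , refl
  unmap (v ∷ Z) inG with inG (here refl) | unmap Z (inG ∘ there)
  ... | g , refl | Z′ , refl = g ∷ Z′ , refl

  IsClique-inj₁ : ∀ {X′} → IsClique G′ k (map inj₁ X′) → IsClique G k X′
  IsClique-inj₁ {X′} (u , len , adj) = Unique.map⁻ u , trans (sym (length-map inj₁ X′)) len ,
    λ a b a∈ b∈ a≢b → E′⇒E (adj _ _ (∈-map⁺ inj₁ a∈) (∈-map⁺ inj₁ b∈) (a≢b ∘ inj₁-injective)) a≢b

  interSize-inj₁ : ∀ X′ Y′ → interSize G′ (map inj₁ X′) (map inj₁ Y′) ≡ interSize G X′ Y′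
  interSize-inj₁ []       Y′ = refl
  interSize-inj₁ (a ∷ X′) Y′
    with DecMembership._∈?_ _≟ᴳ_ a Y′ | DecMembership._∈?_ (Graph._≟_ G′) (inj₁ a) (map inj₁ Y′)
  ... | yes _  | yes _  = cong suc (interSize-inj₁ X′ Y′)
  ... | no _   | no _   = interSize-inj₁ X′ Y′
  ... | yes a∈ | no a∉  = ⊥-elim (a∉ (∈-map⁺ inj₁ a∈))
  ... | no a∉  | yes a∈ = ⊥-elim (a∉ (∈-map-inj₁⁻ a∈))

  ∖-inj₁ : ∀ {X′ Y′ : List (V G)} {a} → map inj₁ X′ ∖ map inj₁ Y′ ≐ inj₁ a → X′ ∖ Y′ ≐ a
  ∖-inj₁ (a∈ , a∉ , only) = ∈-map-inj₁⁻ a∈ , a∉ ∘ ∈-map⁺ inj₁ ,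
    λ v v∈ v∉ → inj₁-injective (only (inj₁ v) (∈-map⁺ inj₁ v∈) (v∉ ∘ ∈-map-inj₁⁻))

  clique-through-off⇒G : ∀ {Z g} → IsClique G′ k Z → inj₁ g ∈ Z → OffTriangle g → ∀ {v} → v ∈ Z → InG v
  clique-through-off⇒G {g = g} (_ , _ , adj) g∈ off {v} v∈ with Graph._≟_ G′ v (inj₁ g)
  ... | yes refl = g , refl
  ... | no v≢g   = adjacent-off⇒G off (adj v (inj₁ g) v∈ g∈ v≢g)

  ∖-inG : ∀ {Z W c} → (∀ {v} → v ∈ Z → InG v) → W ∖ Z ≐ c → InG c → ∀ {v} → v ∈ W → InG v
  ∖-inG {Z} inZ (_ , _ , only) inc {v} v∈ with DecMembership._∈?_ (Graph._≟_ G′) v Z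
  ... | yes v∈Z = inZ v∈Z
  ... | no v∉Z  = subst InG (sym (only v v∈ v∉Z)) inc

  Configuration-inG : ∀ {φ a b} (cfg : Configuration G′ k φ (inj₁ a) (inj₁ b)) → OffTriangle a ⊎ OffTriangle b →
    (∀ {v} → v ∈ Configuration.X cfg → InG v) × (∀ {v} → v ∈ Configuration.Y cfg → InG v)
  Configuration-inG (configuration _ _ cX _ _ dX dY _) (inj₁ off) = inX , ∖-inG inX dY (_ , refl)
    where inX = clique-through-off⇒G cX (proj₁ dX) off
  Configuration-inG (configuration _ _ _ cY _ dX dY _) (inj₂ off) = ∖-inG inY dX (_ , refl) , inY
    where inY = clique-through-off⇒G cY (proj₁ dY) off

  Configuration-G : ∀ {φ a b} → Extendible G k (restrictG φ) → Configuration G′ k φ (inj₁ a) (inj₁ b) →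
    OffTriangle a ⊎ OffTriangle b → E G a b
  Configuration-G ext cfg@(configuration X Y cX cY s dX dY bt) off with Configuration-inG cfg off
  ... | inX , inY with unmap X inX | unmap Y inY
  ... | X′ , refl | Y′ , refl = ext (configuration X′ Y′ (IsClique-inj₁ cX) (IsClique-inj₁ cY)
    (trans (sym (interSize-inj₁ X′ Y′)) s) (∖-inj₁ dX) (∖-inj₁ dY)
    λ w w∈X w∈Y → Between-restrictG (bt (inj₁ w) (∈-map⁺ inj₁ w∈X) (∈-map⁺ inj₁ w∈Y)))

  module SlotSorted (φ : List V′) (key : V′ → ℕ) (sorted : SortedBy key φ)
                (key-lift : ∀ w p → key (liftΓ N x y z w p) ≡ slot w) where

    ⌊key/2⌋-vK : ∀ l → ⌊ key (vK l) /2⌋ ≡ rank l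
    ⌊key/2⌋-vK l = trans (cong ⌊_/2⌋ (key-lift (kv l) tt)) (sym (n≡⌊n+n/2⌋ (rank l)))

    ⌈key/2⌉-vK : ∀ l → ⌈ key (vK l) /2⌉ ≡ rank l
    ⌈key/2⌉-vK l = trans (cong ⌈_/2⌉ (key-lift (kv l) tt)) (sym (n≡⌈n+n/2⌉ (rank l)))

    ⌊key/2⌋-vI : ∀ i j p → ⌊ key (vI i j p) /2⌋ ≡ hU i
    ⌊key/2⌋-vI i j p = trans (cong ⌊_/2⌋ (key-lift (iv i j) p)) (sym (n≡⌈n+n/2⌉ (hU i)))

    ⌈key/2⌉-vI : ∀ i j p → ⌈ key (vI i j p) /2⌉ ≡ suc (hU i)
    ⌈key/2⌉-vI i j p = trans (cong ⌈_/2⌉ (key-lift (iv i j) p)) (cong suc (sym (n≡⌊n+n/2⌋ (hU i))))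

    ⌈key/2⌉≤rank : ∀ {c l} → key c ≤ key (vK l) → ⌈ key c /2⌉ ≤ rank l
    ⌈key/2⌉≤rank {l = l} c≤ = subst (_ ≤_) (⌈key/2⌉-vK l) (⌈n/2⌉-mono c≤)

    rank≤⌊key/2⌋ : ∀ {c l} → key (vK l) ≤ key c → rank l ≤ ⌊ key c /2⌋
    rank≤⌊key/2⌋ {l = l} ≤c = subst (_≤ _) (⌊key/2⌋-vK l) (⌊n/2⌋-mono ≤c)

    rank-between : ∀ {l a b} → Between φ (vK l) a b →
      (⌈ key a /2⌉ ≤ rank l × rank l ≤ ⌊ key b /2⌋) ⊎ (⌈ key b /2⌉ ≤ rank l × rank l ≤ ⌊ key a /2⌋)
    rank-between bt with Between-sortedBy sorted bt
    ... | inj₁ (a≤ , ≤b) = inj₁ (⌈key/2⌉≤rank a≤ , rank≤⌊key/2⌋ ≤b)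
    ... | inj₂ (b≤ , ≤a) = inj₂ (⌈key/2⌉≤rank b≤ , rank≤⌊key/2⌋ ≤a)

    module _ {a b} (link : Link G′ φ (3 + k′) a b) (inK : ∀ {w} → w ∈ Link.common link → IsK w) where
      open Link link

      ¬ranks-in-window : ∀ lo hi → hi ≤ lo + (2 + k′) →
        (∀ {l} → vK l ∈ common → lo ≤ rank l × rank l < hi) → ⊥
      ¬ranks-in-window lo hi narrow bounds = 1+n≰n (begin
        3 + k′             ≡⟨ sym size ⟩
        length common      ≤⟨ length-≤-interval (⌊_/2⌋ ∘ key) unique injective bounds′ ⟩
        hi ∸ lo            ≤⟨ ∸-monoˡ-≤ lo narrow ⟩
        lo + (2 + k′) ∸ lo ≡⟨ m+n∸m≡n lo (2 + k′) ⟩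
        2 + k′             ∎)
        where
        open ≤-Reasoning
        injective : InjectiveOn (⌊_/2⌋ ∘ key) common
        injective w∈ w′∈ eq with inK w∈ | inK w′∈
        ... | l , refl | m , refl =
          cong vK (rank-injective (trans (sym (⌊key/2⌋-vK l)) (trans eq (⌊key/2⌋-vK m))))
        bounds′ : ∀ {w} → w ∈ common → lo ≤ ⌊ key w /2⌋ × ⌊ key w /2⌋ < hi
        bounds′ w∈ with inK w∈
        ... | l , refl = subst (λ r → lo ≤ r × r < hi) (sym (⌊key/2⌋-vK l)) (bounds w∈)

    ¬Link-vI-vK : ∀ i j p m → Near (hU i) (rank m) → ¬ Link G′ φ (3 + k′) (vI i j p) (vK m)
    ¬Link-vI-vK i j p m (h≤ , r≤) link = split (rank m ≤? hU i)
      where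
      open Link link
      inK : ∀ {w} → w ∈ common → IsK w
      inK = adjacent-vI⇒K ∘ adjacentˡ
      rank≢ : ∀ {l} → vK l ∈ common → rank m ≢ rank l
      rank≢ l∈ eq = distinctʳ l∈ (cong vK (rank-injective (sym eq)))
      sides : ∀ {l} → vK l ∈ common →
        (suc (hU i) ≤ rank l × rank l ≤ rank m) ⊎ (rank m ≤ rank l × rank l ≤ hU i)
      sides l∈ with rank-between (betweenᶜ l∈)
      ... | inj₁ (lo , hi) = inj₁ (subst (_≤ _) (⌈key/2⌉-vI i j p) lo , subst (_ ≤_) (⌊key/2⌋-vK m) hi)
      ... | inj₂ (lo , hi) = inj₂ (subst (_≤ _) (⌈key/2⌉-vK m) lo , subst (_ ≤_) (⌊key/2⌋-vI i j p) hi)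
      split : Dec (rank m ≤ hU i) → ⊥
      split (yes r≤h) = ¬ranks-in-window link inK (suc (rank m)) (suc (hU i)) (s≤s h≤) window
        where
        window : ∀ {l} → vK l ∈ common → suc (rank m) ≤ rank l × rank l < suc (hU i)
        window l∈ with sides l∈
        ... | inj₁ (h<r , r≤m) = ⊥-elim (1+n≰n (≤-trans h<r (≤-trans r≤m r≤h)))
        ... | inj₂ (m≤r , r≤h′) = ≤∧≢⇒< m≤r (rank≢ l∈) , s≤s r≤h′
      split (no r≰h) =
        ¬ranks-in-window link inK (suc (hU i)) (rank m) (≤-trans r≤ (≤-reflexive (+-suc (hU i) (2 + k′)))) window
        where
        window : ∀ {l} → vK l ∈ common → suc (hU i) ≤ rank l × rank l < rank m
        window l∈ with sides l∈
        ... | inj₁ (h<r , r≤m) = h<r , ≤∧≢⇒< r≤m (rank≢ l∈ ∘ sym)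
        ... | inj₂ (m≤r , r≤h) = ⊥-elim (r≰h (≤-trans m≤r r≤h))

    ¬Link-vI-vI : ∀ i j p i′ j′ p′ → ¬ Link G′ φ (3 + k′) (vI i j p) (vI i′ j′ p′)
    ¬Link-vI-vI i j p i′ j′ p′ link =
      ¬ranks-in-window link (adjacent-vI⇒K ∘ adjacentˡ) (3 + k′) (4 + k′) narrow window
      where
      open Link link
      narrow : 4 + k′ ≤ (3 + k′) + (2 + k′)
      narrow = ≤-trans (≤-reflexive (+-comm 1 (3 + k′))) (+-monoʳ-≤ (3 + k′) (s≤s z≤n))
      3+k′≤⌈⌉ : ∀ i j p → 3 + k′ ≤ ⌈ key (vI i j p) /2⌉
      3+k′≤⌈⌉ i j p = subst (3 + k′ ≤_) (sym (⌈key/2⌉-vI i j p)) (s≤s (proj₁ (hU-bounds i)))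
      ⌊⌋≤3+k′ : ∀ i j p → ⌊ key (vI i j p) /2⌋ ≤ 3 + k′
      ⌊⌋≤3+k′ i j p = subst (_≤ 3 + k′) (sym (⌊key/2⌋-vI i j p)) (proj₂ (hU-bounds i))
      window : ∀ {l} → vK l ∈ common → 3 + k′ ≤ rank l × rank l < 4 + k′
      window l∈ with rank-between (betweenᶜ l∈)
      ... | inj₁ (lo , hi) = ≤-trans (3+k′≤⌈⌉ i j p) lo , s≤s (≤-trans hi (⌊⌋≤3+k′ i′ j′ p′))
      ... | inj₂ (lo , hi) = ≤-trans (3+k′≤⌈⌉ i′ j′ p′) lo , s≤s (≤-trans hi (⌊⌋≤3+k′ i j p))

    vK-vI-edge : ∀ l i j p → Link G′ φ (3 + k′) (vK l) (vI i j p) → E′ (vK l) (vI i j p)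
    vK-vI-edge l i j p link with l Fin.≟ i | l Fin.≟ j
    ... | no l≢i   | no l≢j   = inj₂ (kv l , iv i j , tt , p , (l≢i , l≢j) , refl , refl)
    ... | yes refl | _        = ⊥-elim (¬Link-vI-vK l j p l (near-i l j p) (Link-swap link))
    ... | no _     | yes refl = ⊥-elim (¬Link-vI-vK i l p l (near-j i l p) (Link-swap link))

    key-extra : ∀ e → key (inj₂ e) ≡ slot (proj₁ e)
    key-extra (kv (suc (suc (suc l))) , p) = key-lift (kv (suc (suc (suc l)))) p
    key-extra (iv i j , p)                 = key-lift (iv i j) p

    -- The common neighbours are among x, y, z, and k − 1 ≥ 3 of them must include y and z,
    -- which lie on opposite sides of every new vertex.
    ¬Link-extra-off : ∀ e {g} → OffTriangle g → ¬ Link G′ φ (3 + k′) (inj₂ e) (inj₁ g)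
    ¬Link-extra-off e off link =
      <⇒≱ (<-trans y<e e<z) (≤-trans (Between-sortedBy-above sorted (betweenᶜ (saturated z∈)) e<z)
                                     (Between-sortedBy-below sorted (betweenᶜ (saturated y∈)) y<e))
      where
      open Link link
      open DecMembership (Graph._≟_ G′) using (_∈?_)
      triangle : List V′
      triangle = inj₁ x ∷ inj₁ y ∷ inj₁ z ∷ []
      y∈ : inj₁ y ∈ triangle
      y∈ = there (here refl)
      z∈ : inj₁ z ∈ triangle
      z∈ = there (there (here refl))
      y<e : key (inj₁ y) < key (inj₂ e)
      y<e = subst₂ _<_ (sym (key-lift (kv (suc (suc zero))) tt)) (sym (key-extra e)) (proj₁ (slot-extra e))
      e<z : key (inj₂ e) < key (inj₁ z)
      e<z = subst₂ _<_ (sym (key-extra e)) (sym (key-lift (kv (suc zero)) tt)) (proj₂ (slot-extra e))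
      common⊆triangle : common ⊆ triangle
      common⊆triangle w∈ with adjacent-off⇒G off (adjacentʳ w∈)
      ... | _ , refl with adjacent-extra⇒onTriangle (adjacentˡ w∈)
      ... | inj₁ refl        = here refl
      ... | inj₂ (inj₁ refl) = y∈
      ... | inj₂ (inj₂ refl) = z∈
      saturated : triangle ⊆ common
      saturated {v} v∈ with v ∈? common
      ... | yes v∈common = v∈common
      ... | no  v∉common = ⊥-elim (<⇒≱ (length-<-missing unique common⊆triangle v∈ v∉common)
                                       (≤-trans (m≤m+n 3 k′) (≤-reflexive (sym size))))

    extendible : Extendible G k (restrictG φ) → Extendible G′ k φ
    extendible ext {a} {b} cfg with view a | view b
    ... | viewK l     | viewK m        = inj₂ (kv l , kv m , tt , tt , (Configuration-≢ cfg ∘ cong vK) , refl , refl)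
    ... | viewK l     | viewI i j p    = vK-vI-edge l i j p (Configuration⇒Link cfg)
    ... | viewI i j p | viewK m        = E′-sym (vK-vI-edge m i j p (Link-swap (Configuration⇒Link cfg)))
    ... | viewI i j p | viewI i′ j′ p′ = ⊥-elim (¬Link-vI-vI i j p i′ j′ p′ (Configuration⇒Link cfg))
    ... | viewI i j p | viewG _ off    = ⊥-elim (¬Link-extra-off _ off (Configuration⇒Link cfg))
    ... | viewG _ off | viewI i j p    = ⊥-elim (¬Link-extra-off _ off (Link-swap (Configuration⇒Link cfg)))
    ... | viewG _ off | viewG _ _      = E⇒E′ (Configuration-G ext cfg (inj₁ off))
    ... | viewG _ off | viewK zero                = E⇒E′ (Configuration-G ext cfg (inj₁ off))
    ... | viewG _ off | viewK (suc zero)          = E⇒E′ (Configuration-G ext cfg (inj₁ off))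
    ... | viewG _ off | viewK (suc (suc zero))    = E⇒E′ (Configuration-G ext cfg (inj₁ off))
    ... | viewG _ off | viewK (suc (suc (suc _))) = ⊥-elim (¬Link-extra-off _ off (Link-swap (Configuration⇒Link cfg)))
    ... | viewK zero                | viewG _ off = E⇒E′ (Configuration-G ext cfg (inj₂ off))
    ... | viewK (suc zero)          | viewG _ off = E⇒E′ (Configuration-G ext cfg (inj₂ off))
    ... | viewK (suc (suc zero))    | viewG _ off = E⇒E′ (Configuration-G ext cfg (inj₂ off))
    ... | viewK (suc (suc (suc _))) | viewG _ off = ⊥-elim (¬Link-extra-off _ off (Configuration⇒Link cfg))

  allΓ : List (ΓV N)
  allΓ = map kv (allFin N) ++ cartesianProductWith iv (allFin N) (allFin N)

  allΓ-unique : Unique allΓ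
  allΓ-unique = Unique.++⁺ (Unique.map⁺ (λ { refl → refl }) (Unique.allFin⁺ N))
    (Unique.cartesianProductWith⁺ iv (λ { refl → refl , refl }) (Unique.allFin⁺ N) (Unique.allFin⁺ N)) disjoint
    where
    disjoint : ∀ {w} → ¬ (w ∈ map kv (allFin N) × w ∈ cartesianProductWith iv (allFin N) (allFin N))
    disjoint (w∈ , w∈′) with ∈-map⁻ kv w∈ | ∈-cartesianProductWith⁻ iv (allFin N) (allFin N) w∈′
    ... | _ , _ , refl | _ , _ , _ , _ , ()

  ∈-allΓ : ∀ w → w ∈ allΓ
  ∈-allΓ (kv l)   = ∈-++⁺ˡ (∈-map⁺ kv (∈-allFin l))
  ∈-allΓ (iv i j) = ∈-++⁺ʳ (map kv (allFin N)) (∈-cartesianProductWith⁺ iv (∈-allFin i) (∈-allFin j))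

  open BucketSort {A = Extra N} (slot ∘ proj₁) top
  open Select (extra {N})

  extras : List (Extra N)
  extras = bucketSort (select allΓ)

  ∈-extras : ∀ e → e ∈ extras
  ∈-extras (w , p) = ∈-bucketSort⁺ (∈-select⁺ (∈-allΓ w) p) (proj₂ (slot-extra (w , p)))

  module Construction (A′ B : List (V G)) (ψ-kce : IsKCEOrdering G k (A′ ++ y ∷ B))
                      (x∈A′ : x ∈ A′) (z∈B : z ∈ B) where

    open DecMembership _≟ᴳ_ using (_∈?_)

    ψ-unique : Unique (A′ ++ y ∷ B)
    ψ-unique = proj₁ (proj₁ ψ-kce)

    A′∌ : ∀ {g} → g ∈ A′ → g ∉ y ∷ B
    A′∌ = Unique-++⇒disjoint A′ ψ-unique

    B∌y : ∀ {g} → g ∈ B → y ≢ g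
    B∌y with AllPairs-++⁻ʳ A′ ψ-unique
    ... | y∉B ∷ _ = All.lookup y∉B

    -- A vertex of G gets the slot of the triangle vertex on its side of y.
    keyG : V G → ℕ
    keyG g with g ≟ᴳ y
    ... | yes _ = 2
    ... | no  _ with g ∈? A′
    ... | yes _ = 0
    ... | no  _ = top

    keyG-y : keyG y ≡ 2
    keyG-y with y ≟ᴳ y
    ... | yes _   = refl
    ... | no  y≢y = ⊥-elim (y≢y refl)

    keyG-A′ : ∀ {g} → g ∈ A′ → keyG g ≡ 0
    keyG-A′ {g} g∈ with g ≟ᴳ y
    ... | yes refl = ⊥-elim (A′∌ g∈ (here refl))
    ... | no  _ with g ∈? A′
    ... | yes _  = refl
    ... | no  g∉ = ⊥-elim (g∉ g∈)

    keyG-B : ∀ {g} → g ∈ B → keyG g ≡ top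
    keyG-B {g} g∈ with g ≟ᴳ y
    ... | yes refl = ⊥-elim (B∌y g∈ refl)
    ... | no  _ with g ∈? A′
    ... | yes g∈A′ = ⊥-elim (A′∌ g∈A′ (there g∈))
    ... | no  _    = refl

    key : V′ → ℕ
    key (inj₁ g)       = keyG g
    key (inj₂ (w , _)) = slot w

    key-lift : ∀ w p → key (liftΓ N x y z w p) ≡ slot w
    key-lift (kv zero)                   _ = keyG-A′ x∈A′
    key-lift (kv (suc zero))             _ = keyG-B z∈B
    key-lift (kv (suc (suc zero)))       _ = keyG-y
    key-lift (kv (suc (suc (suc _))))    _ = refl
    key-lift (iv _ _)                    _ = refl

    ordering : List V′
    ordering = splice (A′ ++ [ y ]) extras B

    ordering-restrict : restrictG ordering ≡ A′ ++ y ∷ B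
    ordering-restrict = trans (restrictG-splice (A′ ++ [ y ]) extras B) (++-assoc A′ [ y ] B)

    ordering-isOrdering : IsOrdering G′ ordering
    ordering-isOrdering =
      Unique-splice (A′ ++ [ y ]) (subst Unique (sym (++-assoc A′ [ y ] B)) ψ-unique)
        (bucketSort-unique (select-unique allΓ-unique)) ,
      ∈-splice (A′ ++ [ y ]) (λ g → subst (g ∈_) (sym (++-assoc A′ [ y ] B)) (proj₂ (proj₁ ψ-kce) g)) ∈-extras

    ordering-sorted : SortedBy key ordering
    ordering-sorted = sortedBy-++ {t = 2} (AllPairs.map⁺ A′y-sorted)
      (sortedBy-++ {t = top} (AllPairs.map⁺ (bucketSort-sorted {xs = select allΓ})) (AllPairs.map⁺ B-sorted)
                             extras≤top top≤B)
      A′y≤2 (All.++⁺ 2≤extras 2≤B)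
      where
      A′y-sorted : SortedBy keyG (A′ ++ [ y ])
      A′y-sorted = sortedBy-++ {t = 0} (sortedBy-const (All.tabulate keyG-A′)) ([] ∷ [])
        (All.tabulate (≤-reflexive ∘ keyG-A′)) (z≤n ∷ [])
      B-sorted : SortedBy keyG B
      B-sorted = sortedBy-const (All.tabulate keyG-B)
      A′y≤2 : All (λ v → key v ≤ 2) (map inj₁ (A′ ++ [ y ]))
      A′y≤2 = All.map⁺ (All.++⁺ (All.tabulate λ g∈ → subst (_≤ 2) (sym (keyG-A′ g∈)) z≤n)
                                (≤-reflexive keyG-y ∷ []))
      2≤extras : All (λ v → 2 ≤ key v) (map inj₂ extras)
      2≤extras = All.map⁺ (All.tabulate λ {e} _ → <⇒≤ (proj₁ (slot-extra e)))
      extras≤top : All (λ v → key v ≤ top) (map inj₂ extras)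
      extras≤top = All.map⁺ (All.tabulate λ {e} _ → <⇒≤ (proj₂ (slot-extra e)))
      2≤B : All (λ v → 2 ≤ key v) (map inj₁ B)
      2≤B = All.map⁺ (All.tabulate λ g∈ →
        subst (2 ≤_) (sym (keyG-B g∈)) (+-mono-≤ {1} {N ∸ 1} (s≤s z≤n) (s≤s z≤n)))
      top≤B : All (λ v → top ≤ key v) (map inj₁ B)
      top≤B = All.map⁺ (All.tabulate (≤-reflexive ∘ sym ∘ keyG-B))

    ordering-kce : IsKCEOrdering G′ k ordering
    ordering-kce = Extendible⇒IsKCEOrdering ordering-isOrdering
      (SlotSorted.extendible ordering key ordering-sorted key-lift
        (subst (Extendible G k) (sym ordering-restrict) (IsKCEOrdering⇒Extendible ψ-kce)))

  extension : (ψ : List (V G)) → IsKCEOrdering G k ψ → Precedes ψ x y → Precedes ψ y z →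
    Σ (List V′) λ φ → IsKCEOrdering G′ k φ × restrictG φ ≡ ψ
  extension ψ ψ-kce (l₁ , l₂ , l₃ , ψ≡) y<z = ordering , ordering-kce , trans ordering-restrict (sym ψ≡′)
    where
    A′ = l₁ ++ x ∷ l₂
    ψ≡′ : ψ ≡ A′ ++ y ∷ l₃
    ψ≡′ = trans ψ≡ (sym (++-assoc l₁ (x ∷ l₂) (y ∷ l₃)))
    ψ-kce′ : IsKCEOrdering G k (A′ ++ y ∷ l₃)
    ψ-kce′ = subst (IsKCEOrdering G k) ψ≡′ ψ-kce
    z∈l₃ : z ∈ l₃
    z∈l₃ = Precedes-after A′ (proj₁ (proj₁ ψ-kce′)) (subst (λ ψ → Precedes ψ y z) ψ≡′ y<z)
    open Construction A′ l₃ ψ-kce′ (∈-++⁺ʳ l₁ (here refl)) z∈l₃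

-- x, y, z are distinct because y lies between x and z in the duplicate-free ψ.
mainTheorem10 : (G : Graph) → IsSimple G → (k : ℕ) → 4 ≤ k →
    (x y z : V G) → x ≢ y → y ≢ z → x ≢ z →
    E G x y → E G y z → E G x z →
    (ψ : List (V G)) → IsKCEOrdering G k ψ → Between ψ y x z →
    Σ (List (V (Ck G k x y z))) λ φ →
    IsKCEOrdering (Ck G k x y z) k φ × restrictG φ ≡ ψ
mainTheorem10 G simple (suc (suc (suc (suc k′)))) (s≤s (s≤s (s≤s (s≤s _)))) x y z _ _ _ xy yz xz ψ ψ-kce
  (inj₁ (x<y , y<z)) = Gluing.extension G simple k′ xy yz xz ψ ψ-kce x<y y<z
mainTheorem10 G simple (suc (suc (suc (suc k′)))) (s≤s (s≤s (s≤s (s≤s _)))) x y z _ _ _ xy yz xz ψ ψ-kce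
  (inj₂ (z<y , y<x))
  with Gluing.extension G simple k′ xy yz xz (reverse ψ) (IsKCEOrdering-reverse ψ-kce)
         (Precedes-reverse y<x) (Precedes-reverse z<y)
... | φ , φ-kce , φ-restrict = reverse φ , IsKCEOrdering-reverse φ-kce , (begin
  restrictG (reverse φ)     ≡⟨ restrictG-reverse φ ⟩
  reverse (restrictG φ)     ≡⟨ cong reverse φ-restrict ⟩
  reverse (reverse ψ)       ≡⟨ reverse-involutive ψ ⟩
  ψ                         ∎)
  where open ≡-Reasoning
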